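{- Let $\mathbb{C}$ and $\mathbb{C}'$ be finite sets of non-trivial clauses such that $\mathbb{C} \vDash \mathbb{C}'$ (every assignment satisfying all clauses of $\mathbb{C}$ satisfies all clauses of $\mathbb{C}'$). Then for every clause $C\in N(\mathbb{C})$ there is a clause $C'\in N(\mathbb{C}')$ such that $C' \subseteq C$, i.e., $C$ is a weakening of $C'$.
   Context: A literal is a Boolean variable $x$ or its negation $\overline{x}$, with $\overline{\overline{x}}=x$. A clause is a disjunction (set) of literals; it is trivial if it contains a variable and its negation; $0$ denotes the empty clause. A clause $C'$ subsumes a clause $C$ if every literal of $C'$ appears in $C$. The negated configuration $N(\mathbb{C})$ of a finite set of clauses $\mathbb{C}$ is defined by induction on $|\mathbb{C}|$: $N(\emptyset)=\{0\}$, and $N(\mathbb{C}\cup\{C\})=\{D\lor \overline{a} : D\in N(\mathbb{C}),\ a\in C\}$, where trivial clauses and clauses subsumed by other clauses are removed from the resulting set. -}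

module Defs where

open import Data.Nat using (ℕ)
import Data.Nat.Properties as ℕP
open import Data.Bool using (Bool; true; false; not)
open import Data.List using (List; []; _∷_; _++_; [_]; filter; concatMap; map)
open import Data.List.Relation.Unary.All using (All; all?)
open import Data.List.Relation.Unary.Any using (Any; any?)
open import Data.Product using (∃; _×_; _,_)
open import Relation.Nullary using (¬_; Dec; yes; no; _×-dec_; ¬?)
open import Relation.Binary.PropositionalEquality using (_≡_; refl; cong)
open import Relation.Binary.Definitions using (DecidableEquality)

data Literal : Set where
  pos : ℕ → Literal
  neg : ℕ → Literal

‾_ : Literal → Literal
‾ pos x = neg x
‾ neg x = pos x

_≟L_ : DecidableEquality Literal
pos x ≟L pos y with x ℕP.≟ y
... | yes refl = yes refl
... | no x≢y = no λ { refl → x≢y refl }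
pos x ≟L neg y = no λ ()
neg x ≟L pos y = no λ ()
neg x ≟L neg y with x ℕP.≟ y
... | yes refl = yes refl
... | no x≢y = no λ { refl → x≢y refl }

open import Data.List.Membership.DecPropositional _≟L_ public using (_∈_; _∈?_)

-- A clause is a finite set of literals (as a list); [] is the empty clause 0.
Clause : Set
Clause = List Literal


_⊑_ : Clause → Clause → Set
C' ⊑ C = All (_∈ C) C'

_⊑?_ : (C' C : Clause) → Dec (C' ⊑ C)
C' ⊑? C = all? (_∈? C) C'

Trivial : Clause → Set
Trivial C = Any (λ l → (‾ l) ∈ C) C

trivial? : (C : Clause) → Dec (Trivial C)
trivial? C = any? (λ l → (‾ l) ∈? C) C

-- C is strictly subsumed by some other clause of the set 𝔻
-- (equal clauses are not removed against each other; as sets they coincide).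
StrictlySubsumedIn : List Clause → Clause → Set
StrictlySubsumedIn 𝔻 C = Any (λ D → D ⊑ C × ¬ (C ⊑ D)) 𝔻

strictlySubsumedIn? : (𝔻 : List Clause) (C : Clause) → Dec (StrictlySubsumedIn 𝔻 C)
strictlySubsumedIn? 𝔻 C = any? (λ D → (D ⊑? C) ×-dec ¬? (C ⊑? D)) 𝔻

reduce : List Clause → List Clause
reduce 𝔻 = filter (λ C → ¬? (strictlySubsumedIn? 𝔻₀ C)) 𝔻₀
  where
  𝔻₀ = filter (λ C → ¬? (trivial? C)) 𝔻

N : List Clause → List Clause
N [] = [] ∷ []
N (C ∷ ℂ) = reduce (concatMap (λ D → map (λ a → D ++ [ ‾ a ]) C) (N ℂ))

Assignment : Set
Assignment = ℕ → Bool

evalLit : Assignment → Literal → Bool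
evalLit σ (pos x) = σ x
evalLit σ (neg x) = not (σ x)

Satisfies : Assignment → Clause → Set
Satisfies σ C = Any (λ l → evalLit σ l ≡ true) C

_⊨_ : List Clause → List Clause → Set
ℂ ⊨ ℂ' = (σ : Assignment) → All (Satisfies σ) ℂ → All (Satisfies σ) ℂ'

-- A clause X of N(ℂ) is non-trivial and contains the complement of some literal of every
-- clause of ℂ, so every assignment falsifying X satisfies ℂ, hence ℂ'. For a non-trivial
-- clause C of ℂ', some assignment falsifies X and C together unless X already contains the
-- complement of a literal of C; so X meets every clause of ℂ' in this way. Picking such a
-- literal for each clause of ℂ' builds a non-trivial clause of the unreduced N(ℂ') inside X,
-- and the reduction keeps a subsumption-minimal clause below it.
module Submission where

open import Defs hiding (_∈_)
open import Data.Bool using (false; not)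
open import Data.Bool.Properties using (not-involutive; not-injective)
open import Data.Empty using (⊥-elim)
open import Data.List using (List; []; _∷_; _++_; [_]; filter; concatMap; map)
open import Data.List.Membership.Propositional using (_∈_; find; lose)
open import Data.List.Membership.Propositional.Properties
  using (∈-++⁻; ∈-++⁺ˡ; ∈-++⁺ʳ; ∈-filter⁺; ∈-filter⁻; ∈-concatMap⁺; ∈-concatMap⁻; ∈-map⁺; ∈-map⁻)
open import Data.List.Relation.Unary.All using (All; []; _∷_; lookup; lookupAny; tabulate)
import Data.List.Relation.Unary.All as All
open import Data.List.Relation.Unary.All.Properties using (++⁺; ++⁻)
open import Data.List.Relation.Unary.Any using (Any; here; there; any?)
import Data.List.Relation.Unary.Any as Any
open import Data.Product using (∃; ∃₂; _×_; _,_; proj₁; proj₂)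
open import Data.Sum using (_⊎_; inj₁; inj₂)
open import Relation.Nullary using (¬_; does; yes; no; ¬?; _×-dec_)
open import Relation.Binary.PropositionalEquality using (_≡_; refl; sym; trans; subst)

‾-involutive : (l : Literal) → ‾ ‾ l ≡ l
‾-involutive (pos x) = refl
‾-involutive (neg x) = refl

evalLit-‾ : ∀ σ l → evalLit σ (‾ l) ≡ not (evalLit σ l)
evalLit-‾ σ (pos x) = refl
evalLit-‾ σ (neg x) = sym (not-involutive (σ x))

⊑-refl : ∀ {C} → C ⊑ C
⊑-refl = tabulate (λ l∈ → l∈)

⊑-trans : ∀ {C D E} → C ⊑ D → D ⊑ E → C ⊑ E
⊑-trans C⊑D D⊑E = All.map (lookup D⊑E) C⊑D

trivial-⊑ : ∀ {C D} → C ⊑ D → Trivial C → Trivial D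
trivial-⊑ C⊑D t with find t
... | l , l∈C , ‾l∈C = lose (lookup C⊑D l∈C) (lookup C⊑D ‾l∈C)

Hits : Clause → Clause → Set
Hits X C = Any (λ a → ‾ a ∈ X) C

trivial-++ : ∀ C D → Trivial (C ++ D) → Trivial C ⊎ Trivial D ⊎ Hits C D
trivial-++ C D t with find t
... | l , l∈ , ‾l∈ with ∈-++⁻ C l∈ | ∈-++⁻ C ‾l∈
... | inj₁ l∈C | inj₁ ‾l∈C = inj₁ (lose l∈C ‾l∈C)
... | inj₂ l∈D | inj₂ ‾l∈D = inj₂ (inj₁ (lose l∈D ‾l∈D))
... | inj₂ l∈D | inj₁ ‾l∈C = inj₂ (inj₂ (lose l∈D ‾l∈C))
... | inj₁ l∈C | inj₂ ‾l∈D =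
  inj₂ (inj₂ (lose ‾l∈D (subst (_∈ C) (sym (‾-involutive l)) l∈C)))

Falsifies : Assignment → Clause → Set
Falsifies σ C = All (λ l → evalLit σ l ≡ false) C

falsifies⇒¬satisfies : ∀ {σ C} → Falsifies σ C → ¬ Satisfies σ C
falsifies⇒¬satisfies f s with lookupAny f s
... | ff , tt with trans (sym ff) tt
...   | ()

canonicalFalsifier : Clause → Assignment
canonicalFalsifier X x = does (neg x ∈? X)

canonicalFalsifier-falsifies : ∀ {X} → ¬ Trivial X → Falsifies (canonicalFalsifier X) X
canonicalFalsifier-falsifies {X} X-nonTrivial = tabulate falsified
  where
  falsified : ∀ {l} → l ∈ X → evalLit (canonicalFalsifier X) l ≡ false
  falsified {pos x} l∈ with neg x ∈? X
  ... | yes ‾l∈ = ⊥-elim (X-nonTrivial (lose l∈ ‾l∈))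
  ... | no _    = refl
  falsified {neg x} l∈ with neg x ∈? X
  ... | yes _   = refl
  ... | no l∉   = ⊥-elim (l∉ l∈)

falsifies-hits⇒satisfies : ∀ {σ X C} → Falsifies σ X → Hits X C → Satisfies σ C
falsifies-hits⇒satisfies {σ} f = Any.map λ {a} ‾a∈X →
  not-injective (trans (sym (evalLit-‾ σ a)) (lookup f ‾a∈X))

falsifiers-satisfy⇒hits : ∀ {X C} → ¬ Trivial X → ¬ Trivial C
  → (∀ σ → Falsifies σ X → Satisfies σ C) → Hits X C
falsifiers-satisfy⇒hits {X} {C} X-nonTrivial C-nonTrivial H with any? (λ a → ‾ a ∈? X) C
... | yes h = h
... | no ¬h = ⊥-elim (falsifies⇒¬satisfies falsifiesC (H σ falsifiesX))
  where
  nonTrivial : ¬ Trivial (X ++ C)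
  nonTrivial t with trivial-++ X C t
  ... | inj₁ tX        = X-nonTrivial tX
  ... | inj₂ (inj₁ tC) = C-nonTrivial tC
  ... | inj₂ (inj₂ h)  = ¬h h
  σ : Assignment
  σ = canonicalFalsifier (X ++ C)
  falsifiesX : Falsifies σ X
  falsifiesX = proj₁ (++⁻ X (canonicalFalsifier-falsifies nonTrivial))
  falsifiesC : Falsifies σ C
  falsifiesC = proj₂ (++⁻ X (canonicalFalsifier-falsifies nonTrivial))

MinimalSubsumerIn : List Clause → Clause → Set
MinimalSubsumerIn 𝔻 X = ∃ λ Y → Y ∈ 𝔻 × Y ⊑ X × ¬ StrictlySubsumedIn 𝔻 Y

strictlySubsumedIn-tail : ∀ {D 𝔻} → StrictlySubsumedIn (D ∷ 𝔻) D → StrictlySubsumedIn 𝔻 D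
strictlySubsumedIn-tail (here (_ , D⋢D)) = ⊥-elim (D⋢D ⊑-refl)
strictlySubsumedIn-tail (there s)        = s

minimalSubsumerIn-⊑ : ∀ {𝔻 X Z} → MinimalSubsumerIn 𝔻 Z → Z ⊑ X → MinimalSubsumerIn 𝔻 X
minimalSubsumerIn-⊑ (Y , Y∈ , Y⊑Z , Y-min) Z⊑X = Y , Y∈ , ⊑-trans Y⊑Z Z⊑X , Y-min

minimalSubsumerIn-∷ : ∀ {D 𝔻 X} → MinimalSubsumerIn 𝔻 X → MinimalSubsumerIn (D ∷ 𝔻) X
minimalSubsumerIn-∷ {D} {𝔻} (Y , Y∈ , Y⊑X , Y-min) with (D ⊑? Y) ×-dec ¬? (Y ⊑? D)
... | yes (D⊑Y , Y⋢D) = D , here refl , ⊑-trans D⊑Y Y⊑X , D-min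
  where
  D-min : ¬ StrictlySubsumedIn (D ∷ 𝔻) D
  D-min s = Y-min (Any.map (λ { (Z⊑D , D⋢Z) → ⊑-trans Z⊑D D⊑Y , λ Y⊑Z → Y⋢D (⊑-trans Y⊑Z Z⊑D) })
                           (strictlySubsumedIn-tail s))
... | no ¬D⊏Y = Y , there Y∈ , Y⊑X , Y-min′
  where
  Y-min′ : ¬ StrictlySubsumedIn (D ∷ 𝔻) Y
  Y-min′ (here D⊏Y) = ¬D⊏Y D⊏Y
  Y-min′ (there s)  = Y-min s

minimalSubsumerIn : ∀ {𝔻 X} → X ∈ 𝔻 → MinimalSubsumerIn 𝔻 X
minimalSubsumerIn (there X∈) = minimalSubsumerIn-∷ (minimalSubsumerIn X∈)
minimalSubsumerIn {D ∷ 𝔻} (here refl) with any? (_⊑? D) 𝔻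
... | yes s with find s
...   | Z , Z∈ , Z⊑D = minimalSubsumerIn-∷ (minimalSubsumerIn-⊑ (minimalSubsumerIn Z∈) Z⊑D)
minimalSubsumerIn {D ∷ 𝔻} (here refl) | no ¬s =
  D , here refl , ⊑-refl , λ s → ¬s (Any.map proj₁ (strictlySubsumedIn-tail s))

nonTrivials : List Clause → List Clause
nonTrivials = filter (λ C → ¬? (trivial? C))

∈-reduce⁻ : ∀ 𝔻 {X} → X ∈ reduce 𝔻 → X ∈ 𝔻 × ¬ Trivial X
∈-reduce⁻ 𝔻 X∈ = ∈-filter⁻ (λ C → ¬? (trivial? C))
  (proj₁ (∈-filter⁻ (λ C → ¬? (strictlySubsumedIn? (nonTrivials 𝔻) C)) X∈))

reduce-subsumes : ∀ 𝔻 {X} → X ∈ 𝔻 → ¬ Trivial X → Any (_⊑ X) (reduce 𝔻)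
reduce-subsumes 𝔻 X∈ X-nonTrivial
  with minimalSubsumerIn (∈-filter⁺ (λ C → ¬? (trivial? C)) X∈ X-nonTrivial)
... | Y , Y∈ , Y⊑X , Y-min =
  lose (∈-filter⁺ (λ C → ¬? (strictlySubsumedIn? (nonTrivials 𝔻) C)) Y∈ Y-min) Y⊑X

extensions : Clause → List Clause → List Clause
extensions C 𝔻 = concatMap (λ D → map (λ a → D ++ [ ‾ a ]) C) 𝔻

∈-extensions⁺ : ∀ {C 𝔻 D a} → D ∈ 𝔻 → a ∈ C → D ++ [ ‾ a ] ∈ extensions C 𝔻
∈-extensions⁺ {C} D∈ a∈ =
  ∈-concatMap⁺ (λ D → map (λ a → D ++ [ ‾ a ]) C) (lose D∈ (∈-map⁺ (λ a → _ ++ [ ‾ a ]) a∈))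

∈-extensions⁻ : ∀ {C 𝔻 X} → X ∈ extensions C 𝔻 → ∃₂ λ D a → D ∈ 𝔻 × a ∈ C × X ≡ D ++ [ ‾ a ]
∈-extensions⁻ {C} X∈ with find (∈-concatMap⁻ (λ D → map (λ a → D ++ [ ‾ a ]) C) X∈)
... | D , D∈ , X∈D with ∈-map⁻ (λ a → D ++ [ ‾ a ]) X∈D
...   | a , a∈ , X≡ = D , a , D∈ , a∈ , X≡

N-nonTrivial : ∀ ℂ {X} → X ∈ N ℂ → ¬ Trivial X
N-nonTrivial []      (here refl) ()
N-nonTrivial (C ∷ ℂ) X∈ = proj₂ (∈-reduce⁻ (extensions C (N ℂ)) X∈)

N-hits : ∀ ℂ {X} → X ∈ N ℂ → All (Hits X) ℂ
N-hits []      _  = []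
N-hits (C ∷ ℂ) X∈ with ∈-extensions⁻ (proj₁ (∈-reduce⁻ (extensions C (N ℂ)) X∈))
... | D , a , D∈ , a∈ , refl =
  lose a∈ (∈-++⁺ʳ D (here refl)) ∷ All.map (Any.map ∈-++⁺ˡ) (N-hits ℂ D∈)

hits⇒N-subsumes : ∀ ℂ {X} → ¬ Trivial X → All (Hits X) ℂ → Any (_⊑ X) (N ℂ)
hits⇒N-subsumes []      _            _        = here []
hits⇒N-subsumes (C ∷ ℂ) {X} X-nonTrivial (h ∷ hs)
  with find (hits⇒N-subsumes ℂ X-nonTrivial hs) | find h
... | D , D∈ , D⊑X | a , a∈ , ‾a∈X =
  Any.map (λ E⊑ → ⊑-trans E⊑ extension⊑X)
    (reduce-subsumes (extensions C (N ℂ)) (∈-extensions⁺ D∈ a∈)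
      (λ t → X-nonTrivial (trivial-⊑ extension⊑X t)))
  where
  extension⊑X : (D ++ [ ‾ a ]) ⊑ X
  extension⊑X = ++⁺ D⊑X (‾a∈X ∷ [])

N-falsifier-satisfies : ∀ ℂ {σ X} → X ∈ N ℂ → Falsifies σ X → All (Satisfies σ) ℂ
N-falsifier-satisfies ℂ X∈ f = All.map (falsifies-hits⇒satisfies f) (N-hits ℂ X∈)

lemma3p6 : (ℂ ℂ' : List Clause)
    → All (λ C → ¬ Trivial C) ℂ
    → All (λ C → ¬ Trivial C) ℂ'
    → ℂ ⊨ ℂ'
    → All (λ C → Any (λ C' → C' ⊑ C) (N ℂ')) (N ℂ)
lemma3p6 ℂ ℂ' _ ℂ'-nonTrivial ℂ⊨ℂ' = tabulate subsumed
  where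
  subsumed : ∀ {X} → X ∈ N ℂ → Any (_⊑ X) (N ℂ')
  subsumed {X} X∈ = hits⇒N-subsumes ℂ' X-nonTrivial (tabulate λ C∈ →
    falsifiers-satisfy⇒hits X-nonTrivial (lookup ℂ'-nonTrivial C∈)
      (λ σ f → lookup (ℂ⊨ℂ' σ (N-falsifier-satisfies ℂ X∈ f)) C∈))
    where
    X-nonTrivial : ¬ Trivial X
    X-nonTrivial = N-nonTrivial ℂ X∈
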